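{- For every finite rooted ordered tree $T$, $(T^*)^*=T$ (as rooted ordered trees on the same vertex set).
   Context: For a rooted ordered tree $T$ with root $r$, $rmc_T(u)$ is the rightmost child and $ils_T(u)$ the immediate left sibling of $u$ in $T$. The dual $T^*$ has the same vertex set and root $r$, with parents and sibling order given by: (1a) $r$ has no parent in $T^*$; (1b) if $v=rmc_T(r)$ then $v$ is the rightmost child of $r$ in $T^*$; (2) if $v=rmc_T(u)$ with $u\ne r$, then $v$ is the immediate left sibling of $u$ in $T^*$ (so $v$ and $u$ have the same parent in $T^*$); (3) if $v=ils_T(u)$, then $v$ is the rightmost child of $u$ in $T^*$. $T^*$ is itself a rooted ordered tree, so $(T^*)^*$ is defined. -}

module Defs where

open import Data.Nat using (ℕ; suc)
open import Data.Fin using (Fin)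
open import Data.List using (List; []; _∷_; _++_; [_])
open import Data.List.Membership.Propositional using (_∈_; _∉_)
open import Data.List.Relation.Unary.Unique.Propositional using (Unique)
open import Data.Product using (Σ; _×_; ∃)
open import Relation.Binary.PropositionalEquality using (_≡_; _≢_)

record Tree (n : ℕ) : Set where
  field
    root     : Fin n
    children : Fin n → List (Fin n)
    children-unique : ∀ u → Unique (children u)
    root-orphan     : ∀ u → root ∉ children u
    parent-unique   : ∀ v → v ≢ root →
                      Σ (Fin n) λ u → (v ∈ children u) × (∀ w → v ∈ children w → w ≡ u)
    -- acyclicity (hence connectedness): a depth function
    depth       : Fin n → ℕ
    depth-root  : depth root ≡ 0
    depth-child : ∀ u v → v ∈ children u → depth v ≡ suc (depth u)

open Tree public

Rmc : ∀ {n} → Tree n → Fin n → Fin n → Set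
Rmc T u v = ∃ λ xs → children T u ≡ xs ++ [ v ]

Ils : ∀ {n} → Tree n → Fin n → Fin n → Set
Ils T u v = Σ (Fin n) λ p → Σ (List (Fin n)) λ xs → Σ (List (Fin n)) λ ys →
              children T p ≡ xs ++ v ∷ u ∷ ys
  where n = _

-- S is the dual T* of T: same vertex set and root, with rules (1b), (2), (3).
-- (1a) holds automatically since the root of S is a root.
record IsDual {n : ℕ} (T S : Tree n) : Set where
  field
    same-root : root S ≡ root T
    rule1b    : ∀ v → Rmc T (root T) v → Rmc S (root T) v
    rule2     : ∀ u v → u ≢ root T → Rmc T u v → Ils S u v
    rule3     : ∀ u v → Ils T u v → Rmc S u v

_≈T_ : ∀ {n} → Tree n → Tree n → Set
T ≈T U = (root T ≡ root U) × (∀ u → children T u ≡ children U u)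

-- In T*, the rightmost child of u is its left sibling in T (the rightmost child of r if u = r),
-- and by rule (2) its left neighbours are the successive T-rightmost children below it.  So the
-- T*-children of u are x = rmc_{T*}(u) preceded by the T-rightmost path descending from x, and the
-- T*-depth of v ≠ r is one plus the number of right siblings summed over the T-path from r to v.
-- Dualising twice, rules (2) and (3) trade places, so every rightmost-child and immediate-left-
-- sibling relation of T holds in T**.  Reading a children list of T from the right, this makes it
-- a suffix of the corresponding list of T**, and an extra vertex in front would have two parents.
module Submission where

open import Defs
open import Data.Nat using (ℕ; zero; suc; _+_; _≤_; _<_; s≤s; s≤s⁻¹)
open import Data.Nat.Properties using (≰⇒>; <-irrefl; m≤n⇒m<n∨m≡n; +-suc; m≤m+n; suc-injective; 0≢1+n; n≤0⇒n≡0; ≤-refl; <-trans; ≤-<-trans)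
open import Data.Fin using (Fin; toℕ; _≟_)
open import Data.Fin.Properties using (pigeonhole; toℕ<n)
open import Data.List using (List; []; _∷_; _++_; [_]; length; last)
open import Data.List.Properties using (++-assoc; ++-identityʳ; ∷-injectiveˡ)
open import Data.List.Membership.Propositional using (_∈_; _∉_)
open import Data.List.Membership.Propositional.Properties using (∈-++⁺ˡ; ∈-++⁺ʳ; ∈-++⁻; ∈-∃++)
open import Data.List.Relation.Unary.Any using (here; there)
open import Data.List.Relation.Unary.All as All using (All; []; _∷_)
import Data.List.Relation.Unary.All.Properties as Allₚ
open import Data.List.Relation.Unary.AllPairs using ([]; _∷_)
open import Data.List.Relation.Unary.Unique.Propositional using (Unique)
open import Data.List.Relation.Unary.Unique.Propositional.Properties using (++⁺; Unique[x∷xs]⇒x∉xs)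
open import Data.Maybe using (Maybe; just; nothing; maybe)
open import Data.Maybe.Properties using (just-injective)
open import Data.Product using (Σ; ∃; ∃₂; _×_; _,_; proj₁; proj₂)
open import Data.Sum using (_⊎_; inj₁; inj₂)
open import Data.Empty using (⊥-elim)
open import Relation.Nullary using (yes; no; ¬_)
open import Relation.Binary.Definitions using (DecidableEquality)
open import Relation.Binary.PropositionalEquality using (_≡_; _≢_; refl; sym; trans; cong; subst; module ≡-Reasoning)
open import Function using (_∘_)

module _ {A : Set} where

  last-∷ʳ : ∀ xs (x : A) → last (xs ++ [ x ]) ≡ just x
  last-∷ʳ []           x = refl
  last-∷ʳ (_ ∷ [])     x = refl
  last-∷ʳ (_ ∷ y ∷ ys) x = last-∷ʳ (y ∷ ys) x

  last≡just⇒∷ʳ : ∀ {xs} {x : A} → last xs ≡ just x → ∃ λ ys → xs ≡ ys ++ [ x ]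
  last≡just⇒∷ʳ {y ∷ []}     refl = [] , refl
  last≡just⇒∷ʳ {y ∷ z ∷ zs} eq   =
    let ys , p = last≡just⇒∷ʳ {z ∷ zs} eq in y ∷ ys , cong (y ∷_) p

  Unique⇒∉-prefix : ∀ xs {v : A} {ys} → Unique (xs ++ v ∷ ys) → v ∉ xs
  Unique⇒∉-prefix (x ∷ xs) (x∉ ∷ _) (here v≡x)  = All.lookup x∉ (∈-++⁺ʳ xs (here refl)) (sym v≡x)
  Unique⇒∉-prefix (x ∷ xs) (_ ∷ u)  (there v∈) = Unique⇒∉-prefix xs u v∈

  ∈-split : ∀ {xs ys zs} {v : A} → xs ≡ ys ++ v ∷ zs → v ∈ xs
  ∈-split {ys = ys} refl = ∈-++⁺ʳ ys (here refl)

module _ {A : Set} (_≟ᴬ_ : DecidableEquality A) where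

  before : A → List A → List A
  before v []       = []
  before v (x ∷ xs) with x ≟ᴬ v
  ... | yes _ = []
  ... | no  _ = x ∷ before v xs

  after : A → List A → List A
  after v []       = []
  after v (x ∷ xs) with x ≟ᴬ v
  ... | yes _ = xs
  ... | no  _ = after v xs

  ∈⇒before-after : ∀ {v} xs → v ∈ xs → xs ≡ before v xs ++ v ∷ after v xs
  ∈⇒before-after {v} (x ∷ xs) v∈ with x ≟ᴬ v | v∈
  ... | yes refl | _          = refl
  ... | no x≢v   | here v≡x   = ⊥-elim (x≢v (sym v≡x))
  ... | no _     | there v∈xs = cong (x ∷_) (∈⇒before-after xs v∈xs)

  before-++-∷ : ∀ {v} xs ys → v ∉ xs → before v (xs ++ v ∷ ys) ≡ xs
  before-++-∷ {v} [] ys _ with v ≟ᴬ v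
  ... | yes _   = refl
  ... | no v≢v = ⊥-elim (v≢v refl)
  before-++-∷ {v} (x ∷ xs) ys v∉ with x ≟ᴬ v
  ... | yes x≡v = ⊥-elim (v∉ (here (sym x≡v)))
  ... | no _    = cong (x ∷_) (before-++-∷ xs ys (v∉ ∘ there))

  after-++-∷ : ∀ {v} xs ys → v ∉ xs → after v (xs ++ v ∷ ys) ≡ ys
  after-++-∷ {v} [] ys _ with v ≟ᴬ v
  ... | yes _   = refl
  ... | no v≢v = ⊥-elim (v≢v refl)
  after-++-∷ {v} (x ∷ xs) ys v∉ with x ≟ᴬ v
  ... | yes x≡v = ⊥-elim (v∉ (here (sym x≡v)))
  ... | no _    = after-++-∷ xs ys (v∉ ∘ there)

  Unique-split : ∀ {v : A} xs ys as bs → Unique (xs ++ v ∷ ys) →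
                 xs ++ v ∷ ys ≡ as ++ v ∷ bs → xs ≡ as × ys ≡ bs
  Unique-split {v} xs ys as bs u eq =
      trans (sym (before-++-∷ xs ys v∉xs)) (trans (cong (before v) eq) (before-++-∷ as bs v∉as))
    , trans (sym (after-++-∷ xs ys v∉xs)) (trans (cong (after v) eq) (after-++-∷ as bs v∉as))
    where
      v∉xs : v ∉ xs
      v∉xs = Unique⇒∉-prefix xs u
      v∉as : v ∉ as
      v∉as = Unique⇒∉-prefix as (subst Unique eq u)

module TreeFacts {n : ℕ} (T : Tree n) where

  child≢root : ∀ {p v} → v ∈ children T p → v ≢ root T
  child≢root {p} v∈ refl = root-orphan T p v∈

  parent : Fin n → Fin n
  parent v with v ≟ root T
  ... | yes _   = root T
  ... | no v≢r = proj₁ (parent-unique T v v≢r)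

  ∈-parent : ∀ {v} → v ≢ root T → v ∈ children T (parent v)
  ∈-parent {v} v≢r with v ≟ root T
  ... | yes v≡r  = ⊥-elim (v≢r v≡r)
  ... | no v≢r′ = proj₁ (proj₂ (parent-unique T v v≢r′))

  parent-≡ : ∀ {p v} → v ∈ children T p → parent v ≡ p
  parent-≡ {p} {v} v∈ with v ≟ root T
  ... | yes v≡r = ⊥-elim (child≢root v∈ v≡r)
  ... | no v≢r  = sym (proj₂ (proj₂ (parent-unique T v v≢r)) p v∈)

  ∈-children-injective : ∀ {p q v} → v ∈ children T p → v ∈ children T q → p ≡ q
  ∈-children-injective v∈p v∈q = trans (sym (parent-≡ v∈p)) (parent-≡ v∈q)

  depth-parent : ∀ {v} → v ≢ root T → depth T v ≡ suc (depth T (parent v))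
  depth-parent v≢r = depth-child T _ _ (∈-parent v≢r)

  parent-induction : (P : Fin n → Set) → P (root T) →
                     (∀ {v} → v ≢ root T → P (parent v) → P v) → ∀ v → P v
  parent-induction P P-root P-step v = go (depth T v) v refl
    where
      go : ∀ d v → depth T v ≡ d → P v
      go d v dv with v ≟ root T
      ... | yes refl = P-root
      ... | no v≢r with d
      ...   | zero   = ⊥-elim (0≢1+n (trans (sym dv) (depth-parent v≢r)))
      ...   | suc d′ = P-step v≢r (go d′ (parent v) (suc-injective (trans (sym (depth-parent v≢r)) dv)))

  parent-depth-< : ∀ {p v} → v ∈ children T p → depth T p < depth T v
  parent-depth-< {p} {v} v∈ = subst (depth T p <_) (sym (depth-child T p v v∈)) ≤-refl

  depth-levels : ∀ v k → k ≤ depth T v → ∃ λ w → depth T w ≡ k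
  depth-levels = parent-induction _ at-root at-child
    where
      at-root : ∀ k → k ≤ depth T (root T) → ∃ λ w → depth T w ≡ k
      at-root k k≤ = root T , trans (depth-root T) (sym (n≤0⇒n≡0 (subst (k ≤_) (depth-root T) k≤)))
      at-child : ∀ {v} → v ≢ root T → (∀ k → k ≤ depth T (parent v) → ∃ λ w → depth T w ≡ k) →
                 ∀ k → k ≤ depth T v → ∃ λ w → depth T w ≡ k
      at-child {v} v≢r ih k k≤ with m≤n⇒m<n∨m≡n k≤
      ... | inj₂ k≡ = v , sym k≡
      ... | inj₁ k< = ih k (s≤s⁻¹ (subst (k <_) (depth-parent v≢r) k<))

  depth<n : ∀ v → depth T v < n
  depth<n v = ≰⇒> λ n≤d →
    let i , j , i<j , same = pigeonhole (s≤s n≤d) vertexAt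
    in <-irrefl (trans (sym (levelOf i)) (trans (cong (depth T) same) (levelOf j))) i<j
    where
      vertexAt : Fin (suc (depth T v)) → Fin n
      vertexAt k = proj₁ (depth-levels v (toℕ k) (s≤s⁻¹ (toℕ<n k)))
      levelOf : ∀ k → depth T (vertexAt k) ≡ toℕ k
      levelOf k = proj₂ (depth-levels v (toℕ k) (s≤s⁻¹ (toℕ<n k)))

  children-split-unique : ∀ {p q v xs ys as bs} → children T p ≡ xs ++ v ∷ ys →
                          children T q ≡ as ++ v ∷ bs → xs ≡ as × ys ≡ bs
  children-split-unique {p} {q} {v} {xs} {ys} {as} {bs} eqp eqq =
    Unique-split _≟_ xs ys as bs (subst Unique eqp (children-unique T p))
      (trans (sym eqp) (trans (cong (children T) p≡q) eqq))
    where
      p≡q : p ≡ q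
      p≡q = ∈-children-injective (∈-split eqp) (∈-split eqq)

  Rmc⇒∈ : ∀ {u v} → Rmc T u v → v ∈ children T u
  Rmc⇒∈ (xs , eq) = ∈-split eq

  Ils⇒∈ : ∀ {u v} → (ils : Ils T u v) → u ∈ children T (proj₁ ils)
  Ils⇒∈ (p , xs , ys , eq) = ∈-split {ys = xs ++ [ _ ]} (trans eq (sym (++-assoc xs _ _)))

  Ils⇒≢root : ∀ {u v} → Ils T u v → u ≢ root T
  Ils⇒≢root ils = child≢root (Ils⇒∈ ils)

  Ils⇒left≢root : ∀ {u v} → Ils T u v → v ≢ root T
  Ils⇒left≢root (p , xs , ys , eq) = child≢root (∈-split eq)

  Rmc⇒¬Ils : ∀ {p u x} → Rmc T p x → ¬ Ils T u x
  Rmc⇒¬Ils (as , eqp) (q , xs , ys , eqq) with children-split-unique eqp eqq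
  ... | _ , ()

  Ils-injective : ∀ {u u′ x} → Ils T u x → Ils T u′ x → u ≡ u′
  Ils-injective (q , xs , ys , eq) (q′ , xs′ , ys′ , eq′) =
    ∷-injectiveˡ (proj₂ (children-split-unique eq eq′))

module Dual {n : ℕ} (T : Tree n) where

  open TreeFacts T

  private
    r : Fin n
    r = root T

  rightmost : Fin n → Maybe (Fin n)
  rightmost u = last (children T u)

  Rmc⇒rightmost : ∀ {u v} → Rmc T u v → rightmost u ≡ just v
  Rmc⇒rightmost {u} {v} (xs , eq) = trans (cong last eq) (last-∷ʳ xs v)

  rightmost⇒Rmc : ∀ {u v} → rightmost u ≡ just v → Rmc T u v
  rightmost⇒Rmc = last≡just⇒∷ʳ

  leftSibling : Fin n → Maybe (Fin n)
  leftSibling u = last (before _≟_ u (children T (parent u)))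

  Ils⇒leftSibling : ∀ {u v} → Ils T u v → leftSibling u ≡ just v
  Ils⇒leftSibling {u} {v} ils@(p , xs , ys , eq) = begin
    last (before _≟_ u (children T (parent u)))
      ≡⟨ cong (λ q → last (before _≟_ u (children T q))) (parent-≡ (Ils⇒∈ ils)) ⟩
    last (before _≟_ u (children T p))
      ≡⟨ cong (last ∘ before _≟_ u) eq′ ⟩
    last (before _≟_ u ((xs ++ [ v ]) ++ u ∷ ys))
      ≡⟨ cong last (before-++-∷ _≟_ (xs ++ [ v ]) ys u∉) ⟩
    last (xs ++ [ v ])
      ≡⟨ last-∷ʳ xs v ⟩
    just v
      ∎
    where
      open ≡-Reasoning
      eq′ : children T p ≡ (xs ++ [ v ]) ++ u ∷ ys
      eq′ = trans eq (sym (++-assoc xs [ v ] (u ∷ ys)))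
      u∉ : u ∉ xs ++ [ v ]
      u∉ = Unique⇒∉-prefix (xs ++ [ v ]) (subst Unique eq′ (children-unique T p))

  leftSibling⇒Ils : ∀ {u v} → u ≢ r → leftSibling u ≡ just v → Ils T u v
  leftSibling⇒Ils {u} {v} u≢r eq =
    parent u , xs , after _≟_ u siblings ,
    trans (∈⇒before-after _≟_ siblings (∈-parent u≢r))
          (trans (cong (_++ u ∷ after _≟_ u siblings) before≡) (++-assoc xs [ v ] _))
    where
      siblings : List (Fin n)
      siblings = children T (parent u)
      before-last : ∃ λ xs → before _≟_ u siblings ≡ xs ++ [ v ]
      before-last = last≡just⇒∷ʳ {xs = before _≟_ u siblings} eq
      xs : List (Fin n)
      xs = proj₁ before-last
      before≡ : before _≟_ u siblings ≡ xs ++ [ v ]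
      before≡ = proj₂ before-last

  dualRmc : Fin n → Maybe (Fin n)
  dualRmc u with u ≟ r
  ... | yes _ = rightmost r
  ... | no  _ = leftSibling u

  dualRmc-root : ∀ {x} → Rmc T r x → dualRmc r ≡ just x
  dualRmc-root rmc with r ≟ r
  ... | yes _   = Rmc⇒rightmost rmc
  ... | no r≢r = ⊥-elim (r≢r refl)

  dualRmc-Ils : ∀ {u x} → Ils T u x → dualRmc u ≡ just x
  dualRmc-Ils {u} ils with u ≟ r
  ... | yes u≡r = ⊥-elim (Ils⇒≢root ils u≡r)
  ... | no  _   = Ils⇒leftSibling ils

  dualRmc-inv : ∀ {u x} → dualRmc u ≡ just x → (u ≡ r × Rmc T r x) ⊎ Ils T u x
  dualRmc-inv {u} eq with u ≟ r
  ... | yes u≡r = inj₁ (u≡r , rightmost⇒Rmc eq)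
  ... | no  u≢r = inj₂ (leftSibling⇒Ils u≢r eq)

  dualRmc-injective : ∀ {u u′ x} → dualRmc u ≡ just x → dualRmc u′ ≡ just x → u ≡ u′
  dualRmc-injective {u} {u′} eq eq′ with dualRmc-inv {u} eq | dualRmc-inv {u′} eq′
  ... | inj₁ (u≡r , _)   | inj₁ (u′≡r , _)  = trans u≡r (sym u′≡r)
  ... | inj₁ (_ , rmc)   | inj₂ ils′        = ⊥-elim (Rmc⇒¬Ils rmc ils′)
  ... | inj₂ ils         | inj₁ (_ , rmc′)  = ⊥-elim (Rmc⇒¬Ils rmc′ ils)
  ... | inj₂ ils         | inj₂ ils′        = Ils-injective ils ils′

  SpineTop : Fin n → Set
  SpineTop x = x ≢ r × (∀ {y} → Rmc T y x → y ≡ r)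

  dualRmc-SpineTop : ∀ {u x} → dualRmc u ≡ just x → SpineTop x
  dualRmc-SpineTop {u} eq with dualRmc-inv {u} eq
  ... | inj₁ (_ , rmc) =
    child≢root (Rmc⇒∈ rmc) , λ rmc′ → ∈-children-injective (Rmc⇒∈ rmc′) (Rmc⇒∈ rmc)
  ... | inj₂ ils =
    Ils⇒left≢root ils , λ rmc′ → ⊥-elim (Rmc⇒¬Ils rmc′ ils)

  rightSiblings : Fin n → ℕ
  rightSiblings v = length (after _≟_ v (children T (parent v)))

  rightSiblings-split : ∀ {p xs v ys} → children T p ≡ xs ++ v ∷ ys → rightSiblings v ≡ length ys
  rightSiblings-split {p} {xs} {v} {ys} eq = cong length (begin
    after _≟_ v (children T (parent v))
      ≡⟨ cong (λ q → after _≟_ v (children T q)) (parent-≡ (∈-split eq)) ⟩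
    after _≟_ v (children T p)
      ≡⟨ cong (after _≟_ v) eq ⟩
    after _≟_ v (xs ++ v ∷ ys)
      ≡⟨ after-++-∷ _≟_ xs ys (Unique⇒∉-prefix xs (subst Unique eq (children-unique T p))) ⟩
    ys
      ∎)
    where open ≡-Reasoning

  rightSiblingsUpTo : ℕ → Fin n → ℕ
  rightSiblingsUpTo zero    v = 0
  rightSiblingsUpTo (suc k) v = rightSiblings v + rightSiblingsUpTo k (parent v)

  pathRightSiblings : Fin n → ℕ
  pathRightSiblings v = rightSiblingsUpTo (depth T v) v

  pathRightSiblings-root : pathRightSiblings r ≡ 0
  pathRightSiblings-root = cong (λ k → rightSiblingsUpTo k r) (depth-root T)

  pathRightSiblings-child : ∀ {p v} → v ∈ children T p →
                            pathRightSiblings v ≡ rightSiblings v + pathRightSiblings p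
  pathRightSiblings-child {p} {v} v∈ = begin
    rightSiblingsUpTo (depth T v) v
      ≡⟨ cong (λ k → rightSiblingsUpTo k v) (depth-child T p v v∈) ⟩
    rightSiblings v + rightSiblingsUpTo (depth T p) (parent v)
      ≡⟨ cong (λ q → rightSiblings v + rightSiblingsUpTo (depth T p) q) (parent-≡ v∈) ⟩
    rightSiblings v + rightSiblingsUpTo (depth T p) p
      ∎
    where open ≡-Reasoning

  dualDepth : Fin n → ℕ
  dualDepth v with v ≟ r
  ... | yes _ = 0
  ... | no  _ = suc (pathRightSiblings v)

  dualDepth-root : dualDepth r ≡ 0
  dualDepth-root with r ≟ r
  ... | yes _   = refl
  ... | no r≢r = ⊥-elim (r≢r refl)

  dualDepth-≢root : ∀ {v} → v ≢ r → dualDepth v ≡ suc (pathRightSiblings v)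
  dualDepth-≢root {v} v≢r with v ≟ r
  ... | yes v≡r = ⊥-elim (v≢r v≡r)
  ... | no  _   = refl

  dualDepth-split : ∀ {p xs v ys} → children T p ≡ xs ++ v ∷ ys →
                    dualDepth v ≡ suc (length ys + pathRightSiblings p)
  dualDepth-split eq = trans (dualDepth-≢root (child≢root (∈-split eq)))
    (cong suc (trans (pathRightSiblings-child (∈-split eq)) (cong (_+ _) (rightSiblings-split eq))))

  dualDepth-Rmc : ∀ {p v} → p ≢ r → Rmc T p v → dualDepth v ≡ dualDepth p
  dualDepth-Rmc p≢r (_ , eq) = trans (dualDepth-split eq) (sym (dualDepth-≢root p≢r))

  dualDepth-Rmc-root : ∀ {v} → Rmc T r v → dualDepth v ≡ 1
  dualDepth-Rmc-root (_ , eq) = trans (dualDepth-split eq) (cong suc pathRightSiblings-root)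

  dualDepth-Ils : ∀ {u v} → Ils T u v → dualDepth v ≡ suc (dualDepth u)
  dualDepth-Ils {u} {v} (p , xs , ys , eq) = trans (dualDepth-split eq)
    (cong suc (sym (dualDepth-split (trans eq (sym (++-assoc xs [ v ] (u ∷ ys)))))))

  dualDepth-dualRmc : ∀ {u x} → dualRmc u ≡ just x → dualDepth x ≡ suc (dualDepth u)
  dualDepth-dualRmc {u} eq with dualRmc-inv {u} eq
  ... | inj₁ (refl , rmc) = trans (dualDepth-Rmc-root rmc) (cong suc (sym dualDepth-root))
  ... | inj₂ ils          = dualDepth-Ils ils

  rightPath : ℕ → Fin n → List (Fin n)
  rightPath zero    x = []
  rightPath (suc f) x = maybe (λ y → rightPath f y ++ [ y ]) [] (rightmost x)

  -- With fuel f the path is cut after f steps; fuel n never cuts it, since depths are below n.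
  spine : ℕ → Fin n → List (Fin n)
  spine f x = rightPath f x ++ [ x ]

  ∈-spine : ∀ f x → x ∈ spine f x
  ∈-spine f x = ∈-++⁺ʳ (rightPath f x) (here refl)

  spine-All : ∀ {P : Fin n → Set} → (∀ {y z} → Rmc T y z → P y → P z) →
              ∀ f x → P x → All P (spine f x)
  spine-All step zero    x Px = Px ∷ []
  spine-All step (suc f) x Px with rightmost x in eq
  ... | nothing = Px ∷ []
  ... | just y  = Allₚ.++⁺ (spine-All step f y (step (rightmost⇒Rmc eq) Px)) (Px ∷ [])

  spine-≢root : ∀ f {x w} → x ≢ r → w ∈ spine f x → w ≢ r
  spine-≢root f {x} x≢r = All.lookup (spine-All (λ rmc _ → child≢root (Rmc⇒∈ rmc)) f x x≢r)

  spine-dualDepth : ∀ f {x w} → x ≢ r → w ∈ spine f x → dualDepth w ≡ dualDepth x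
  spine-dualDepth f {x} x≢r w∈ = proj₂ (All.lookup (spine-All step f x (x≢r , refl)) w∈)
    where
      step : ∀ {y z} → Rmc T y z →
             y ≢ r × dualDepth y ≡ dualDepth x → z ≢ r × dualDepth z ≡ dualDepth x
      step rmc (y≢r , dy) = child≢root (Rmc⇒∈ rmc) , trans (dualDepth-Rmc y≢r rmc) dy

  spine-Unique : ∀ f x → Unique (spine f x)
  spine-Unique zero    x = [] ∷ []
  spine-Unique (suc f) x with rightmost x in eq
  ... | nothing = [] ∷ []
  ... | just y  = ++⁺ (spine-Unique f y) ([] ∷ []) x∉
    where
      deeper : All (λ w → depth T x < depth T w) (spine f y)
      deeper = spine-All (λ rmc x<y → <-trans x<y (parent-depth-< (Rmc⇒∈ rmc)))
                         f y (parent-depth-< (Rmc⇒∈ (rightmost⇒Rmc eq)))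
      x∉ : ∀ {w} → ¬ (w ∈ spine f y × w ∈ [ x ])
      x∉ (w∈ , here refl) = <-irrefl refl (All.lookup deeper w∈)

  spine-∈ : ∀ f x {w} → w ∈ spine f x → w ≡ x ⊎ ∃ λ y → y ∈ spine f x × Rmc T y w
  rightPath-∈ : ∀ f x {w} → w ∈ rightPath f x → ∃ λ y → y ∈ spine f x × Rmc T y w
  spine-∈ f x w∈ with ∈-++⁻ (rightPath f x) w∈
  ... | inj₁ w∈path   = inj₂ (rightPath-∈ f x w∈path)
  ... | inj₂ (here refl) = inj₁ refl
  rightPath-∈ (suc f) x w∈ with rightmost x in eq
  ... | just y with spine-∈ f y w∈
  ...   | inj₁ refl            = x , ∈-++⁺ʳ (spine f y) (here refl) , rightmost⇒Rmc eq
  ...   | inj₂ (y′ , y′∈ , rmc) = y′ , ∈-++⁺ˡ y′∈ , rmc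

  spine-Rmc : ∀ f x {y z} → n ≤ f + depth T x → y ∈ spine f x → Rmc T y z →
              ∃₂ λ bs cs → spine f x ≡ bs ++ z ∷ y ∷ cs
  spine-Rmc zero x n≤ (here refl) rmc =
    ⊥-elim (<-irrefl refl (≤-<-trans n≤ (<-trans (parent-depth-< (Rmc⇒∈ rmc)) (depth<n _))))
  spine-Rmc (suc f) x n≤ y∈ rmc with rightmost x in eq
  spine-Rmc (suc f) x n≤ (here refl) rmc | nothing with () ← trans (sym eq) (Rmc⇒rightmost rmc)
  ... | just x′ with ∈-++⁻ (spine f x′) y∈
  ...   | inj₂ (here refl) with refl ← just-injective (trans (sym eq) (Rmc⇒rightmost rmc)) =
            rightPath f x′ , [] , ++-assoc (rightPath f x′) [ x′ ] [ x ]
  ...   | inj₁ y∈′ =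
            let bs , cs , eq′ = spine-Rmc f x′ n≤′ y∈′ rmc
            in bs , cs ++ [ x ] , trans (cong (_++ [ x ]) eq′) (++-assoc bs _ [ x ])
    where
      n≤′ : n ≤ f + depth T x′
      n≤′ = subst (n ≤_) (trans (sym (+-suc f (depth T x))) (cong (f +_) (sym x′-depth))) n≤
        where
          x′-depth : depth T x′ ≡ suc (depth T x)
          x′-depth = depth-child T x x′ (Rmc⇒∈ (rightmost⇒Rmc eq))

  spineTop-unique : ∀ v f f′ {x x′} → SpineTop x → SpineTop x′ →
                    v ∈ spine f x → v ∈ spine f′ x′ → x ≡ x′
  spineTop-unique = parent-induction TopDetermined at-root at-child
    where
      TopDetermined : Fin n → Set
      TopDetermined v = ∀ f f′ {x x′} → SpineTop x → SpineTop x′ →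
                        v ∈ spine f x → v ∈ spine f′ x′ → x ≡ x′

      at-root : TopDetermined r
      at-root f _ (x≢r , _) _ r∈ _ = ⊥-elim (spine-≢root f x≢r r∈ refl)

      top-not-below : ∀ {f x x′ y} → SpineTop x → SpineTop x′ → y ∈ spine f x′ → ¬ Rmc T y x
      top-not-below {f} (_ , top) (x′≢r , _) y∈ rmc = spine-≢root f x′≢r y∈ (top rmc)

      at-child : ∀ {v} → v ≢ r → TopDetermined (parent v) → TopDetermined v
      at-child {v} _ ih f f′ {x} {x′} top top′ v∈ v∈′ with spine-∈ f x v∈ | spine-∈ f′ x′ v∈′
      ... | inj₁ refl             | inj₁ refl              = refl
      ... | inj₁ refl             | inj₂ (y′ , y′∈ , rmc′) = ⊥-elim (top-not-below {f′} top top′ y′∈ rmc′)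
      ... | inj₂ (y , y∈ , rmc)   | inj₁ refl              = ⊥-elim (top-not-below {f} top′ top y∈ rmc)
      ... | inj₂ (y , y∈ , rmc)   | inj₂ (y′ , y′∈ , rmc′) =
        ih f f′ top top′ (subst (_∈ spine f x) (sym (parent-≡ (Rmc⇒∈ rmc))) y∈)
                    (subst (_∈ spine f′ x′) (sym (parent-≡ (Rmc⇒∈ rmc′))) y′∈)

  dualChildren : Fin n → List (Fin n)
  dualChildren u = maybe (spine n) [] (dualRmc u)

  dualChildren-just : ∀ u {x} → dualRmc u ≡ just x → dualChildren u ≡ spine n x
  dualChildren-just _ = cong (maybe (spine n) [])

  dualChildren-∈ : ∀ u {w} → w ∈ dualChildren u → ∃ λ x → dualRmc u ≡ just x × w ∈ spine n x
  dualChildren-∈ u w∈ with dualRmc u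
  ... | just x = x , refl , w∈

  dualParent-unique : ∀ {u u′ w} → w ∈ dualChildren u → w ∈ dualChildren u′ → u ≡ u′
  dualParent-unique {u} {u′} {w} w∈ w∈′ =
    let x  , eq  , w∈x  = dualChildren-∈ u w∈
        x′ , eq′ , w∈x′ = dualChildren-∈ u′ w∈′
        x≡x′ = spineTop-unique w n n (dualRmc-SpineTop {u} eq) (dualRmc-SpineTop {u′} eq′) w∈x w∈x′
    in dualRmc-injective {u} {u′} eq (subst (λ y → dualRmc u′ ≡ just y) (sym x≡x′) eq′)

  dualParent-exists : ∀ v → v ≢ r → ∃ λ u → v ∈ dualChildren u
  dualParent-exists = parent-induction HasDualParent (λ r≢r → ⊥-elim (r≢r refl)) at-child
    where
      HasDualParent : Fin n → Set
      HasDualParent v = v ≢ r → ∃ λ u → v ∈ dualChildren u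

      in-spine : ∀ u {x w} → dualRmc u ≡ just x → w ∈ spine n x → ∃ λ u → w ∈ dualChildren u
      in-spine u {w = w} eq w∈ = u , subst (w ∈_) (sym (dualChildren-just u eq)) w∈

      at-child : ∀ {v} → v ≢ r → HasDualParent (parent v) → HasDualParent v
      at-child {v} v≢r ih _ with ∈-∃++ (∈-parent v≢r)
      ... | xs , w ∷ ys , eq = in-spine w (dualRmc-Ils (parent v , xs , ys , eq)) (∈-spine n v)
      ... | xs , []     , eq with parent v ≟ r
      ...   | yes p≡r = in-spine r (dualRmc-root (subst (λ p → Rmc T p v) p≡r (xs , eq))) (∈-spine n v)
      ...   | no  p≢r =
        let u , p∈         = ih p≢r
            x , eqx , p∈x  = dualChildren-∈ u p∈
            bs , cs , eqs  = spine-Rmc n x (m≤m+n n _) p∈x (xs , eq)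
        in in-spine u eqx (subst (v ∈_) (sym eqs) (∈-split {ys = bs} refl))

  dualChildren-Unique : ∀ u → Unique (dualChildren u)
  dualChildren-Unique u with dualRmc u
  ... | nothing = []
  ... | just x  = spine-Unique n x

  root∉dualChildren : ∀ u → r ∉ dualChildren u
  root∉dualChildren u r∈ =
    let x , eq , r∈x = dualChildren-∈ u r∈
    in spine-≢root n (proj₁ (dualRmc-SpineTop {u} eq)) r∈x refl

  dualDepth-dualChild : ∀ u v → v ∈ dualChildren u → dualDepth v ≡ suc (dualDepth u)
  dualDepth-dualChild u v v∈ =
    let x , eq , v∈x = dualChildren-∈ u v∈
    in trans (spine-dualDepth n (proj₁ (dualRmc-SpineTop {u} eq)) v∈x) (dualDepth-dualRmc {u} eq)

  dual : Tree n
  dual = record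
    { root            = r
    ; children        = dualChildren
    ; children-unique = dualChildren-Unique
    ; root-orphan     = root∉dualChildren
    ; parent-unique   = λ v v≢r →
        let u , v∈ = dualParent-exists v v≢r in u , v∈ , λ w v∈w → dualParent-unique v∈w v∈
    ; depth           = dualDepth
    ; depth-root      = dualDepth-root
    ; depth-child     = dualDepth-dualChild
    }

  dual-IsDual : IsDual T dual
  dual-IsDual = record
    { same-root = refl
    ; rule1b    = λ v rmc → rightPath n v , dualChildren-just r (dualRmc-root rmc)
    ; rule2     = rule2
    ; rule3     = λ u v ils → rightPath n v , dualChildren-just u (dualRmc-Ils ils)
    }
    where
      rule2 : ∀ u v → u ≢ r → Rmc T u v → Ils dual u v
      rule2 u v u≢r rmc =
        let p , u∈         = dualParent-exists u u≢r
            x , eq , u∈x   = dualChildren-∈ p u∈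
            bs , cs , eqs  = spine-Rmc n x (m≤m+n n _) u∈x rmc
        in p , bs , cs , trans (dualChildren-just p eq) eqs

module _ {n : ℕ} {T U : Tree n} (same-root : root U ≡ root T)
         (Rmc⊆ : ∀ {u v} → Rmc T u v → Rmc U u v) (Ils⊆ : ∀ {u v} → Ils T u v → Ils U u v) where

  private
    module T = TreeFacts T
    module U = TreeFacts U

  children-suffix : ∀ u → ∃ λ zs → children U u ≡ zs ++ children T u
  children-suffix u with children T u in eq
  ... | []     = children U u , sym (++-identityʳ _)
  ... | v ∷ vs = go [] v vs eq
    where
      go : ∀ xs v vs → children T u ≡ xs ++ v ∷ vs → ∃ λ zs → children U u ≡ zs ++ v ∷ vs
      go xs v []       eq = Rmc⊆ (xs , eq)
      go xs v (w ∷ vs) eq =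
        let zs , eqU       = go (xs ++ [ v ]) w vs (trans eq (sym (++-assoc xs [ v ] (w ∷ vs))))
            p , as , bs , eqp = Ils⊆ (u , xs , vs , eq)
            as∷ʳv≡zs , _   = U.children-split-unique (trans eqp (sym (++-assoc as [ v ] (w ∷ bs)))) eqU
        in as , trans eqU (trans (cong (_++ w ∷ vs) (sym as∷ʳv≡zs)) (++-assoc as [ v ] (w ∷ vs)))

  children-≡ : ∀ u → children U u ≡ children T u
  children-≡ u with children-suffix u
  ... | []     , eq = eq
  ... | z ∷ zs , eq =
    ⊥-elim (Unique[x∷xs]⇒x∉xs (subst Unique eq (children-unique U u)) (∈-++⁺ʳ zs z∈T))
    where
      z∈U : z ∈ children U u
      z∈U = subst (z ∈_) (sym eq) (here refl)
      z≢root : z ≢ root T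
      z≢root z≡r = U.child≢root z∈U (trans z≡r (sym same-root))
      z∈Tparent : z ∈ children T (T.parent z)
      z∈Tparent = T.∈-parent z≢root
      z∈Uparent : z ∈ children U (T.parent z)
      z∈Uparent = let zs′ , eq′ = children-suffix (T.parent z)
                  in subst (z ∈_) (sym eq′) (∈-++⁺ʳ zs′ z∈Tparent)
      z∈T : z ∈ children T u
      z∈T = subst (λ p → z ∈ children T p) (U.∈-children-injective z∈Uparent z∈U) z∈Tparent

module _ {n : ℕ} {T S U : Tree n} (S-dual : IsDual T S) (U-dual : IsDual S U) where

  private
    module S* = IsDual S-dual
    module U* = IsDual U-dual

  root-dual² : root U ≡ root T
  root-dual² = trans U*.same-root S*.same-root

  Rmc-dual² : ∀ {u v} → Rmc T u v → Rmc U u v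
  Rmc-dual² {u} {v} rmc with u ≟ root T
  ... | yes refl = subst (λ q → Rmc U q v) S*.same-root
                     (U*.rule1b v (subst (λ q → Rmc S q v) (sym S*.same-root) (S*.rule1b v rmc)))
  ... | no  u≢r  = U*.rule3 u v (S*.rule2 u v u≢r rmc)

  Ils-dual² : ∀ {u v} → Ils T u v → Ils U u v
  Ils-dual² {u} {v} ils = U*.rule2 u v u≢rootS (S*.rule3 u v ils)
    where
      u≢rootS : u ≢ root S
      u≢rootS u≡ = TreeFacts.Ils⇒≢root T ils (trans u≡ S*.same-root)

  dual²-≈T : U ≈T T
  dual²-≈T = root-dual² , children-≡ {T = T} {U = U} root-dual² Rmc-dual² Ils-dual²

theorem4 : (n : ℕ) →
    ((T : Tree n) → Σ (Tree n) (IsDual T)) ×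
    ((T S U : Tree n) → IsDual T S → IsDual S U → U ≈T T)
theorem4 n = (λ T → Dual.dual T , Dual.dual-IsDual T) , λ T S U → dual²-≈T
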